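{- For all $n > 0$ and $1 \le k \le 2n-1$, \begin{align*} h^*_{\Delta_{C_n,k}}(t) &= h^*_{\Delta'_{C_n,k}}(t) + (1-t)\left( h^*_{\Delta'_{C_{n-1},k-1}}(t) + h^*_{\Delta_{C_{n-1},k-2}}(t)\right) \\ &= h^*_{\Delta'_{C_n,k}}(t) + \sum_{j \ge 1} (1-t)^j \left( h^*_{\Delta'_{C_{n-j},k-2j+1}}(t) + h^*_{\Delta'_{C_{n-j},k-2j}}(t)\right). \end{align*}
   Context: For $m\ge1$: $\Pi_{C_m} := \{x \in \mathbb{R}^m \mid 0 \le 2x_1 \le 1,\ 0 \le x_i - x_{i-1} \le 1 \ (2 \le i \le m)\}$; for $1\le k\le 2m-1$, $\Delta_{C_m,k} := \{x\in\Pi_{C_m} \mid k-1\le 2x_m\le k\}$; $\Delta'_{C_m,1} := \Delta_{C_m,1}$ and, for $2\le k\le 2m-1$, $\Delta'_{C_m,k} := \{ x \in \Pi_{C_m} \mid k-1 < 2x_m \le k\}$. All Ehrhart quantities are with respect to the lattice $\tfrac12\mathbb{Z}^m$: $L_P(r) := |rP\cap\tfrac12\mathbb{Z}^m|$ where $rP$ is defined by the same weak/strict inequalities with constants multiplied by $r$, and $h^*_P$ is defined by $\sum_{r\ge0}L_P(r)t^r = h^*_P(t)/(1-t)^{m+1}$. Convention: $h^*_{\Delta_{C_m,k}} = h^*_{\Delta'_{C_m,k}} := 0$ whenever $m \le 0$, $k<1$ or $k>2m-1$. -}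

module Defs where

open import Data.Bool using (Bool; true; false; _∧_; if_then_else_)
open import Data.Nat as ℕ using (ℕ; zero; suc; _∸_)
open import Data.Integer as ℤ using (ℤ; +_; _≤ᵇ_; _-_; _+_; _*_; -_)
open import Data.List using (List; []; _∷_; length; filterᵇ; concatMap; map; applyUpTo; foldr)
open import Data.Vec using (Vec; []; _∷_)

-- We work with y = 2x : a point x ∈ ½ℤ^m of r·P corresponds to y ∈ ℤ^m.
-- r·Π_{C_m} (scaled by 2):  0 ≤ y₁ ≤ r,  0 ≤ yᵢ - yᵢ₋₁ ≤ 2r.
-- r·Δ_{C_m,k}  adds  r(k-1) ≤ y_m ≤ rk ;  r·Δ'_{C_m,k} (k ≥ 2) adds r(k-1) < y_m ≤ rk.

_<ᵇ'_ : ℤ → ℤ → Bool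
a <ᵇ' b = (a + + 1) ≤ᵇ b

chainOK : ℕ → ℤ → {n : ℕ} → Vec ℤ n → (ℤ → Bool) → Bool
chainOK r prev []       lastOK = lastOK prev
chainOK r prev (y ∷ ys) lastOK =
  (prev ≤ᵇ y) ∧ (y ≤ᵇ prev + + (2 ℕ.* r)) ∧ chainOK r y ys lastOK

inScaledΠ : ℕ → {m : ℕ} → Vec ℤ m → (ℤ → Bool) → Bool
inScaledΠ r []       lastOK = false   -- m = 0 not considered (convention handles it)
inScaledΠ r (y ∷ ys) lastOK = (+ 0 ≤ᵇ y) ∧ (y ≤ᵇ + r) ∧ chainOK r y ys lastOK

intBox : ℕ → List ℤ
intBox B = applyUpTo (λ i → + i - + B) (suc (2 ℕ.* B))

allVecs : (m : ℕ) → List ℤ → List (Vec ℤ m)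
allVecs zero    xs = [] ∷ []
allVecs (suc m) xs = concatMap (λ x → map (x ∷_) (allVecs m xs)) xs

-- bound B = 2rm: every lattice point of r·Π_{C_m} satisfies |y_i| ≤ r(2m-1) ≤ 2rm
latticeCount : (m r : ℕ) → (ℤ → Bool) → ℕ
latticeCount m r lastOK =
  length (filterᵇ (λ y → inScaledΠ r y lastOK) (allVecs m (intBox (2 ℕ.* r ℕ.* m))))

LΔ : ℕ → ℤ → ℕ → ℕ
LΔ m k r = latticeCount m r (λ ym → ((+ r * (k - + 1)) ≤ᵇ ym) ∧ (ym ≤ᵇ + r * k))

LΔ' : ℕ → ℤ → ℕ → ℕ
LΔ' m k r = if k ≤ᵇ + 1 then LΔ m k r
            else latticeCount m r (λ ym → ((+ r * (k - + 1)) <ᵇ' ym) ∧ (ym ≤ᵇ + r * k))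

Series : Set
Series = ℕ → ℤ

oneMinusT : Series → Series
oneMinusT a zero    = a zero
oneMinusT a (suc i) = a (suc i) - a i

oneMinusTPow : ℕ → Series → Series
oneMinusTPow zero    a = a
oneMinusTPow (suc j) a = oneMinusT (oneMinusTPow j a)

hstarOf : ℕ → (ℕ → ℕ) → Series
hstarOf m L = oneMinusTPow (suc m) (λ r → + L r)

-- validity of (m, k): m ≥ 1 and 1 ≤ k ≤ 2m - 1 ; otherwise h* := 0 (convention)
valid : ℕ → ℤ → Bool
valid zero    k = false
valid (suc m) k = (+ 1 ≤ᵇ k) ∧ (k ≤ᵇ + (2 ℕ.* suc m ∸ 1))

hΔ : ℕ → ℤ → Series
hΔ m k i = if valid m k then hstarOf m (LΔ m k) i else + 0

hΔ' : ℕ → ℤ → Series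
hΔ' m k i = if valid m k then hstarOf m (LΔ' m k) i else + 0

sumFrom1 : ℕ → (ℕ → Series) → Series
sumFrom1 n f i = foldr _+_ (+ 0) (applyUpTo (λ j → f (suc j) i) n)

module Submission where

-- Writing y = 2x, a lattice point of rΠ_{C_m} is an integer chain 0 ≤ y₁ ≤ r, 0 ≤ yᵢ − yᵢ₋₁ ≤ 2r,
-- and each Ehrhart function here counts such chains with y_m in an interval. For k ≥ 2 the points
-- of rΔ_{C_n,k} are those of rΔ'_{C_n,k} together with the slice y_n = r(k−1). In that slice y_{n−1}
-- runs over [r(k−3), r(k−1)], which splits into [r(k−3), r(k−2)] and (r(k−2), r(k−1)]: points of
-- rΔ_{C_{n−1},k−2} and of rΔ'_{C_{n−1},k−1}. So
--   L_Δ(C_n,k) = L_Δ'(C_n,k) + L_Δ'(C_{n−1},k−1) + L_Δ(C_{n−1},k−2),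
-- and as h* multiplies the Ehrhart series by (1−t)^{dim+1}, the two lower-dimensional terms carry one
-- extra factor 1−t. Unfolding the last term repeatedly gives the second identity.

open import Defs
open import Data.Bool using (Bool; true; false; if_then_else_)
open import Data.Integer as ℤ using (ℤ; +_; -[1+_]; +<+; +≤+)
import Data.Integer.Properties as ℤP
import Data.Integer.Tactic.RingSolver as ℤSolver
open import Data.Nat as ℕ using (ℕ; zero; suc; pred; _*_; _∸_; _≤_; _<_; _≤ᵇ_; z≤n; s≤s; _<?_; _≤?_)
import Data.Nat.Properties as ℕP
open import Data.Product using (_×_; _,_)
open import Function using (_∘_)
open import Relation.Binary.PropositionalEquality

module LatticePointCounts where

  open import Data.Nat using (_+_)
  open import Algebra.Properties.CommutativeSemigroup ℕP.+-commutativeSemigroup using (interchange)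
  open import Data.Bool using (T; _∧_)
  open import Data.Bool.Properties using (T-≡; if-eta; ∧-zeroʳ)
  open import Data.Empty using (⊥-elim)
  open import Data.List using (List; []; _∷_; length; filterᵇ; concatMap; map; applyUpTo; _++_)
  open import Data.List.Properties using (length-++; filter-++; map-cong; map-applyUpTo)
  open import Data.Nat.ListAction using (sum)
  open import Data.Nat.Tactic.RingSolver using (solve-∀)
  open import Data.Vec using (Vec; []; _∷_)
  open import Function using (Equivalence)
  open import Relation.Binary.Definitions using (Tri; tri<; tri≈; tri>)
  open import Relation.Nullary using (¬_; yes; no)
  open import Relation.Nullary.Decidable using (T?)

  𝟙 : Bool → ℕ
  𝟙 true  = 1
  𝟙 false = 0

  T⇒≡true : ∀ {b} → T b → b ≡ true
  T⇒≡true = Equivalence.to T-≡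

  ¬T⇒≡false : ∀ {b} → ¬ T b → b ≡ false
  ¬T⇒≡false {false} _  = refl
  ¬T⇒≡false {true}  ¬t = ⊥-elim (¬t _)

  ≤ᵇ-true : ∀ {m n} → m ≤ n → (m ≤ᵇ n) ≡ true
  ≤ᵇ-true = T⇒≡true ∘ ℕP.≤⇒≤ᵇ

  ≤ᵇ-false : ∀ {m n} → n < m → (m ≤ᵇ n) ≡ false
  ≤ᵇ-false {m} {n} n<m = ¬T⇒≡false (ℕP.<⇒≱ n<m ∘ ℕP.≤ᵇ⇒≤ m n)

  ℤ≤ᵇ-false : ∀ {i j} → j ℤ.< i → (i ℤ.≤ᵇ j) ≡ false
  ℤ≤ᵇ-false j<i = ¬T⇒≡false (ℤP.<⇒≱ j<i ∘ ℤP.≤ᵇ⇒≤)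

  if-true : ∀ {b} {x : ℕ} → b ≡ true → (if b then x else 0) ≡ x
  if-true refl = refl

  if-false : ∀ {b} {x : ℕ} → b ≡ false → (if b then x else 0) ≡ 0
  if-false refl = refl

  count : {A : Set} → (A → Bool) → List A → ℕ
  count p xs = length (filterᵇ p xs)

  count-++ : ∀ {A : Set} (p : A → Bool) xs ys → count p (xs ++ ys) ≡ count p xs + count p ys
  count-++ p xs ys = trans (cong length (filter-++ (T? ∘ p) xs ys)) (length-++ (filterᵇ p xs))

  count-concatMap : ∀ {A B : Set} (p : B → Bool) (f : A → List B) xs →
                    count p (concatMap f xs) ≡ sum (map (count p ∘ f) xs)
  count-concatMap p f []       = refl
  count-concatMap p f (x ∷ xs) =
    trans (count-++ p (f x) (concatMap f xs)) (cong (λ n → count p (f x) + n) (count-concatMap p f xs))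

  count-map : ∀ {A B : Set} (p : B → Bool) (g : A → B) xs → count p (map g xs) ≡ count (p ∘ g) xs
  count-map p g []       = refl
  count-map p g (x ∷ xs) with p (g x)
  ... | true  = cong suc (count-map p g xs)
  ... | false = count-map p g xs

  count-∧ : ∀ {A : Set} b (q : A → Bool) xs → count (λ x → b ∧ q x) xs ≡ (if b then count q xs else 0)
  count-∧ true  q xs       = refl
  count-∧ false q []       = refl
  count-∧ false q (x ∷ xs) = count-∧ false q xs

  count-allVecs-suc : ∀ {m} (p : Vec ℤ (suc m) → Bool) xs →
                      count p (allVecs (suc m) xs) ≡ sum (map (λ x → count (p ∘ (x ∷_)) (allVecs m xs)) xs)
  count-allVecs-suc {m} p xs =
    trans (count-concatMap p (λ x → map (x ∷_) (allVecs m xs)) xs)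
          (cong sum (map-cong (λ x → count-map p (x ∷_) (allVecs m xs)) xs))

  sumTo : ℕ → (ℕ → ℕ) → ℕ
  sumTo zero    g = g 0
  sumTo (suc w) g = g 0 + sumTo w (g ∘ suc)

  sumTo-cong : ∀ w {f g : ℕ → ℕ} → (∀ d → d ≤ w → f d ≡ g d) → sumTo w f ≡ sumTo w g
  sumTo-cong zero    f≡g = f≡g 0 z≤n
  sumTo-cong (suc w) f≡g = cong₂ _+_ (f≡g 0 z≤n) (sumTo-cong w (λ d d≤w → f≡g (suc d) (s≤s d≤w)))

  sumTo-+ : ∀ w (f g : ℕ → ℕ) → sumTo w (λ d → f d + g d) ≡ sumTo w f + sumTo w g
  sumTo-+ zero    f g = refl
  sumTo-+ (suc w) f g =
    trans (cong (λ n → f 0 + g 0 + n) (sumTo-+ w (f ∘ suc) (g ∘ suc))) (interchange (f 0) (g 0) _ _)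

  sumTo-zero : ∀ w (f : ℕ → ℕ) → (∀ d → d ≤ w → f d ≡ 0) → sumTo w f ≡ 0
  sumTo-zero zero    f f≡0 = f≡0 0 z≤n
  sumTo-zero (suc w) f f≡0 = cong₂ _+_ (f≡0 0 z≤n) (sumTo-zero w (f ∘ suc) (λ d d≤w → f≡0 (suc d) (s≤s d≤w)))

  sum-applyUpTo-zero : ∀ N (H : ℕ → ℕ) → (∀ i → H i ≡ 0) → sum (applyUpTo H N) ≡ 0
  sum-applyUpTo-zero zero    H H≡0 = refl
  sum-applyUpTo-zero (suc N) H H≡0 = cong₂ _+_ (H≡0 0) (sum-applyUpTo-zero N (H ∘ suc) (H≡0 ∘ suc))

  sum-applyUpTo-window : ∀ N u w (H : ℕ → ℕ) → u + w < N →
                         (∀ i → i < u → H i ≡ 0) → (∀ i → u + w < i → H i ≡ 0) →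
                         sum (applyUpTo H N) ≡ sumTo w (λ d → H (u + d))
  sum-applyUpTo-window (suc N) (suc u) w H (s≤s u+w<N) below above =
    trans (cong (λ n → n + sum (applyUpTo (H ∘ suc) N)) (below 0 (s≤s z≤n)))
          (sum-applyUpTo-window N u w (H ∘ suc) u+w<N (λ i → below (suc i) ∘ s≤s) (λ i → above (suc i) ∘ s≤s))
  sum-applyUpTo-window (suc N) zero zero H _ _ above =
    trans (cong (λ n → H 0 + n) (sum-applyUpTo-zero N (H ∘ suc) (λ i → above (suc i) (s≤s z≤n))))
          (ℕP.+-identityʳ (H 0))
  sum-applyUpTo-window (suc N) zero (suc w) H (s≤s w<N) _ above =
    cong (λ n → H 0 + n) (sum-applyUpTo-window N zero w (H ∘ suc) w<N (λ _ ()) (λ i → above (suc i) ∘ s≤s))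

  data BoxIndex (B : ℕ) : ℕ → Set where
    negative : ∀ {i} → i < B → BoxIndex B i
    shifted  : ∀ j → BoxIndex B (B + j)

  boxIndex : ∀ B i → BoxIndex B i
  boxIndex B i with i <? B
  ... | yes i<B = negative i<B
  ... | no  i≮B = subst (BoxIndex B) (ℕP.m+[n∸m]≡n (ℕP.≮⇒≥ i≮B)) (shifted (i ∸ B))

  negative-value : ∀ {i B} → i < B → + i ℤ.- + B ℤ.< + 0
  negative-value {i} {B} i<B =
    subst (+ i ℤ.- + B ℤ.<_) (ℤP.+-inverseʳ (+ B)) (ℤP.+-monoˡ-< (ℤ.- + B) (+<+ i<B))

  shifted-value : ∀ B j → + (B + j) ℤ.- + B ≡ + j
  shifted-value B j = cancel (+ B) (+ j)
    where
    cancel : ∀ b x → b ℤ.+ x ℤ.- b ≡ x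
    cancel = ℤSolver.solve-∀

  sum-intBox-window : ∀ B p w (H : ℤ → ℕ) → p + w ≤ B →
                      (∀ y → y ℤ.< + p → H y ≡ 0) → (∀ y → + (p + w) ℤ.< y → H y ≡ 0) →
                      sum (map H (intBox B)) ≡ sumTo w (λ d → H (+ (p + d)))
  sum-intBox-window B p w H p+w≤B H-below H-above = begin
    sum (map H (intBox B))
      ≡⟨ cong sum (map-applyUpTo (λ i → + i ℤ.- + B) H (suc (2 * B))) ⟩
    sum (applyUpTo (λ i → H (+ i ℤ.- + B)) (suc (2 * B)))
      ≡⟨ sum-applyUpTo-window _ (B + p) w _ B+p+w<2B+1 below above ⟩
    sumTo w (λ d → H (+ (B + p + d) ℤ.- + B))
      ≡⟨ sumTo-cong w (λ d _ → cong H (value d)) ⟩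
    sumTo w (λ d → H (+ (p + d)))
      ∎
    where
    open ≡-Reasoning
    B+p+w≡B+[p+w] = ℕP.+-assoc B p w
    value : ∀ d → + (B + p + d) ℤ.- + B ≡ + (p + d)
    value d = trans (cong (λ n → + n ℤ.- + B) (ℕP.+-assoc B p d)) (shifted-value B (p + d))
    B+p+w<2B+1 : B + p + w < suc (2 * B)
    B+p+w<2B+1 = s≤s (subst (_≤ 2 * B) (sym B+p+w≡B+[p+w])
                            (ℕP.+-monoʳ-≤ B (subst (p + w ≤_) (sym (ℕP.+-identityʳ B)) p+w≤B)))
    below : ∀ i → i < B + p → H (+ i ℤ.- + B) ≡ 0
    below i i<B+p with boxIndex B i
    ... | negative i<B = H-below _ (ℤP.<-≤-trans (negative-value i<B) (+≤+ z≤n))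
    ... | shifted j    = trans (cong H (shifted-value B j)) (H-below (+ j) (+<+ (ℕP.+-cancelˡ-< B j p i<B+p)))
    above : ∀ i → B + p + w < i → H (+ i ℤ.- + B) ≡ 0
    above i B+p+w<i with boxIndex B i
    ... | negative i<B = ⊥-elim (ℕP.<-asym i<B (ℕP.≤-<-trans (ℕP.m≤m+n B (p + w))
                                                              (subst (_< i) B+p+w≡B+[p+w] B+p+w<i)))
    ... | shifted j    = trans (cong H (shifted-value B j))
                               (H-above (+ j) (+<+ (ℕP.+-cancelˡ-< B (p + w) j
                                                     (subst (_< B + j) B+p+w≡B+[p+w] B+p+w<i))))

  -- The predicate counted on the left is what chainOK and inScaledΠ unfold to on a vector y ∷ ys.
  count-window : ∀ {m} B p w (q : ℤ → Vec ℤ m → Bool) → p + w ≤ B →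
    sum (map (λ y → count (λ ys → (+ p ℤ.≤ᵇ y) ∧ (y ℤ.≤ᵇ + (p + w)) ∧ q y ys) (allVecs m (intBox B)))
             (intBox B))
      ≡ sumTo w (λ d → count (q (+ (p + d))) (allVecs m (intBox B)))
  count-window {m} B p w q p+w≤B =
    trans (cong sum (map-cong gate (intBox B)))
          (trans (sum-intBox-window B p w H p+w≤B below above) (sumTo-cong w inside))
    where
    V = allVecs m (intBox B)
    H : ℤ → ℕ
    H y = if + p ℤ.≤ᵇ y then (if y ℤ.≤ᵇ + (p + w) then count (q y) V else 0) else 0
    gate : ∀ y → count (λ ys → (+ p ℤ.≤ᵇ y) ∧ (y ℤ.≤ᵇ + (p + w)) ∧ q y ys) V ≡ H y
    gate y = trans (count-∧ _ _ V) (cong (λ n → if + p ℤ.≤ᵇ y then n else 0) (count-∧ _ (q y) V))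
    below : ∀ y → y ℤ.< + p → H y ≡ 0
    below y y<p rewrite ℤ≤ᵇ-false y<p = refl
    above : ∀ y → + (p + w) ℤ.< y → H y ≡ 0
    above y p+w<y rewrite ℤ≤ᵇ-false p+w<y = if-eta (+ p ℤ.≤ᵇ y)
    inside : ∀ d → d ≤ w → H (+ (p + d)) ≡ count (q (+ (p + d))) V
    inside d d≤w rewrite ≤ᵇ-true (ℕP.m≤m+n p d) | ≤ᵇ-true (ℕP.+-monoʳ-≤ p d≤w) = refl

  -- Ehrhart functions as chain sums

  -- latticeSum r m f sums f (y_m) over the points y = 2x of rΠ_{C_m} ∩ ½ℤ^m; chainSum r m p f is the
  -- analogous sum over the m further steps of a chain currently at p.
  chainSum : ℕ → ℕ → ℕ → (ℕ → ℕ) → ℕ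
  chainSum r zero    p f = f p
  chainSum r (suc m) p f = sumTo (2 * r) (λ d → chainSum r m (p + d) f)

  latticeSum : ℕ → ℕ → (ℕ → ℕ) → ℕ
  latticeSum r zero    f = 0
  latticeSum r (suc m) f = sumTo r (λ d → chainSum r m d f)

  chainCount-chainSum : ∀ r P B m p → p + m * (2 * r) ≤ B →
    count (λ ys → chainOK r (+ p) ys P) (allVecs m (intBox B)) ≡ chainSum r m p (𝟙 ∘ P ∘ +_)
  chainCount-chainSum r P B zero p _ with P (+ p)
  ... | true  = refl
  ... | false = refl
  chainCount-chainSum r P B (suc m) p reach≤B =
    trans (count-allVecs-suc {m} (λ ys → chainOK r (+ p) ys P) (intBox B))
    (trans (count-window {m} B p (2 * r) (λ y ys → chainOK r y ys P)
                         (ℕP.≤-trans (ℕP.m≤m+n (p + 2 * r) _) reach≤B′))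
           (sumTo-cong (2 * r) (λ d d≤2r → chainCount-chainSum r P B m (p + d)
                                                                (ℕP.≤-trans (step d≤2r) reach≤B′))))
    where
    reach≤B′ : p + 2 * r + m * (2 * r) ≤ B
    reach≤B′ = subst (_≤ B) (sym (ℕP.+-assoc p (2 * r) _)) reach≤B
    step : ∀ {d} → d ≤ 2 * r → p + d + m * (2 * r) ≤ p + 2 * r + m * (2 * r)
    step d≤2r = ℕP.+-monoˡ-≤ (m * (2 * r)) (ℕP.+-monoʳ-≤ p d≤2r)

  latticeCount-latticeSum : ∀ m r P → latticeCount m r P ≡ latticeSum r m (𝟙 ∘ P ∘ +_)
  latticeCount-latticeSum zero    r P = refl
  latticeCount-latticeSum (suc m) r P =
    trans (count-allVecs-suc {m} (λ ys → inScaledΠ r ys P) (intBox B))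
    (trans (count-window {m} B 0 r (λ y ys → chainOK r y ys P) (ℕP.≤-trans (ℕP.m≤m+n r _) top≤B))
           (sumTo-cong r (λ d d≤r → chainCount-chainSum r P B m d (ℕP.≤-trans (ℕP.+-monoˡ-≤ _ d≤r) top≤B))))
    where
    B = 2 * r * suc m
    top≤B : r + m * (2 * r) ≤ B
    top≤B = subst (r + m * (2 * r) ≤_) (identity r m) (ℕP.m≤m+n _ r)
      where
      identity : ∀ r m → r + m * (2 * r) + r ≡ 2 * r * suc m
      identity = solve-∀

  module _ (r : ℕ) where

    chainSum-cong : ∀ m p {f g : ℕ → ℕ} → f ≗ g → chainSum r m p f ≡ chainSum r m p g
    chainSum-cong zero    p f≗g = f≗g p
    chainSum-cong (suc m) p f≗g = sumTo-cong (2 * r) (λ d _ → chainSum-cong m (p + d) f≗g)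

    chainSum-+ : ∀ m p (f g : ℕ → ℕ) →
                 chainSum r m p (λ t → f t + g t) ≡ chainSum r m p f + chainSum r m p g
    chainSum-+ zero    p f g = refl
    chainSum-+ (suc m) p f g =
      trans (sumTo-cong (2 * r) (λ d _ → chainSum-+ m (p + d) f g)) (sumTo-+ (2 * r) _ _)

    chainSum-zero : ∀ m p (f : ℕ → ℕ) → (∀ t → t ≤ p + m * (2 * r) → f t ≡ 0) → chainSum r m p f ≡ 0
    chainSum-zero zero    p f f≡0 = f≡0 p (ℕP.m≤m+n p 0)
    chainSum-zero (suc m) p f f≡0 =
      sumTo-zero (2 * r) _ (λ d d≤2r → chainSum-zero m (p + d) f (λ t t≤ → f≡0 t (ℕP.≤-trans t≤ (reach d≤2r))))
      where
      reach : ∀ {d} → d ≤ 2 * r → p + d + m * (2 * r) ≤ p + suc m * (2 * r)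
      reach {d} d≤2r = subst (p + d + m * (2 * r) ≤_) (ℕP.+-assoc p (2 * r) (m * (2 * r)))
                             (ℕP.+-monoˡ-≤ (m * (2 * r)) (ℕP.+-monoʳ-≤ p d≤2r))

    chainSum-suc : ∀ m p (f : ℕ → ℕ) →
                   chainSum r (suc m) p f ≡ chainSum r m p (λ t → sumTo (2 * r) (λ e → f (t + e)))
    chainSum-suc zero    p f = refl
    chainSum-suc (suc m) p f = sumTo-cong (2 * r) (λ d _ → chainSum-suc m (p + d) f)

    latticeSum-cong : ∀ m {f g : ℕ → ℕ} → f ≗ g → latticeSum r m f ≡ latticeSum r m g
    latticeSum-cong zero    f≗g = refl
    latticeSum-cong (suc m) f≗g = sumTo-cong r (λ d _ → chainSum-cong m d f≗g)

    latticeSum-+ : ∀ m (f g : ℕ → ℕ) →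
                   latticeSum r m (λ t → f t + g t) ≡ latticeSum r m f + latticeSum r m g
    latticeSum-+ zero    f g = refl
    latticeSum-+ (suc m) f g = trans (sumTo-cong r (λ d _ → chainSum-+ m d f g)) (sumTo-+ r _ _)

    latticeSum-zero : ∀ m (f : ℕ → ℕ) → (∀ t → t ≤ r + m * (2 * r) → f t ≡ 0) → latticeSum r (suc m) f ≡ 0
    latticeSum-zero m f f≡0 =
      sumTo-zero r _ (λ d d≤r → chainSum-zero m d f (λ t t≤ → f≡0 t (ℕP.≤-trans t≤ (ℕP.+-monoˡ-≤ _ d≤r))))

    latticeSum-suc : ∀ m (f : ℕ → ℕ) →
                     latticeSum r (suc (suc m)) f ≡ latticeSum r (suc m) (λ t → sumTo (2 * r) (λ e → f (t + e)))
    latticeSum-suc m f = sumTo-cong r (λ d _ → chainSum-suc m d f)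

  indicator : ℕ → ℕ → ℕ → ℕ
  indicator lo hi t = 𝟙 ((lo ≤ᵇ t) ∧ (t ≤ᵇ hi))

  module _ {lo hi t : ℕ} where

    indicator-in : lo ≤ t → t ≤ hi → indicator lo hi t ≡ 1
    indicator-in lo≤t t≤hi rewrite ≤ᵇ-true lo≤t | ≤ᵇ-true t≤hi = refl

    indicator-below : t < lo → indicator lo hi t ≡ 0
    indicator-below t<lo rewrite ≤ᵇ-false t<lo = refl

    indicator-above : hi < t → indicator lo hi t ≡ 0
    indicator-above hi<t rewrite ≤ᵇ-false hi<t | ∧-zeroʳ (lo ≤ᵇ t) = refl

  indicator-split : ∀ {lo mid hi} → lo ≤ mid → mid ≤ hi →
                    ∀ t → indicator lo hi t ≡ indicator lo mid t + indicator (suc mid) hi t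
  indicator-split {lo} {mid} {hi} lo≤mid mid≤hi t with t <? lo
  ... | yes t<lo
    rewrite indicator-below {lo} {hi} t<lo | indicator-below {lo} {mid} t<lo
          | indicator-below {suc mid} {hi} (ℕP.<-≤-trans t<lo (ℕP.m≤n⇒m≤1+n lo≤mid)) = refl
  ... | no t≮lo with t ≤? mid
  ...   | yes t≤mid
    rewrite indicator-in {lo} {hi} (ℕP.≮⇒≥ t≮lo) (ℕP.≤-trans t≤mid mid≤hi)
          | indicator-in {lo} {mid} (ℕP.≮⇒≥ t≮lo) t≤mid
          | indicator-below {suc mid} {hi} (s≤s t≤mid) = refl
  ...   | no t≰mid with t ≤? hi
  ...     | yes t≤hi
    rewrite indicator-in {lo} {hi} (ℕP.≮⇒≥ t≮lo) t≤hi | indicator-above {lo} {mid} (ℕP.≰⇒> t≰mid)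
          | indicator-in {suc mid} {hi} (ℕP.≰⇒> t≰mid) t≤hi = refl
  ...     | no t≰hi
    rewrite indicator-above {lo} {hi} (ℕP.≰⇒> t≰hi) | indicator-above {lo} {mid} (ℕP.≰⇒> t≰mid)
          | indicator-above {suc mid} {hi} (ℕP.≰⇒> t≰hi) = refl

  ≤ᵇ-suc-pred : ∀ x t → (x ≤ᵇ suc t) ≡ (pred x ≤ᵇ t)
  ≤ᵇ-suc-pred zero          t = refl
  ≤ᵇ-suc-pred (suc zero)    t = refl
  ≤ᵇ-suc-pred (suc (suc x)) t = refl

  sumTo-indicator-point : ∀ w c t → sumTo w (λ e → indicator c c (t + e)) ≡ indicator (c ∸ w) c t
  sumTo-indicator-point zero    c t = cong (indicator c c) (ℕP.+-identityʳ t)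
  sumTo-indicator-point (suc w) c t = begin
    indicator c c (t + 0) + sumTo w (λ e → indicator c c (t + suc e))
      ≡⟨ cong₂ _+_ (cong (indicator c c) (ℕP.+-identityʳ t))
                   (trans (sumTo-cong w (λ e _ → cong (indicator c c) (ℕP.+-suc t e)))
                          (sumTo-indicator-point w c (suc t))) ⟩
    indicator c c t + indicator (c ∸ w) c (suc t)
      ≡⟨ widen (ℕP.<-cmp t c) ⟩
    indicator (c ∸ suc w) c t
      ∎
    where
    open ≡-Reasoning
    widen : Tri (t < c) (t ≡ c) (c < t) →
            indicator c c t + indicator (c ∸ w) c (suc t) ≡ indicator (c ∸ suc w) c t
    widen (tri< t<c _ _)
      rewrite indicator-below {c} {c} t<c | ≤ᵇ-true t<c | ≤ᵇ-true (ℕP.<⇒≤ t<c)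
            | ≤ᵇ-suc-pred (c ∸ w) t | ℕP.pred[m∸n]≡m∸[1+n] c w = refl
    widen (tri≈ _ refl _)
      rewrite indicator-in {t} {t} ℕP.≤-refl ℕP.≤-refl | indicator-above {t ∸ w} {t} {suc t} ℕP.≤-refl
            | indicator-in {t ∸ suc w} {t} (ℕP.m∸n≤m t (suc w)) ℕP.≤-refl = refl
    widen (tri> _ _ c<t)
      rewrite indicator-above {c} {c} c<t | indicator-above {c ∸ w} {c} {suc t} (ℕP.m≤n⇒m≤1+n c<t)
            | indicator-above {c ∸ suc w} {c} c<t = refl

  -- The recurrence of Ehrhart functions

  LΔ₀ : ℕ → ℤ → ℕ → ℕ
  LΔ₀ m k r = if valid m k then LΔ m k r else 0

  LΔ'₀ : ℕ → ℤ → ℕ → ℕ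
  LΔ'₀ m k r = if valid m k then LΔ' m k r else 0

  valid-within : ∀ m {k} → k ≤ 2 * m → valid (suc m) (+ suc k) ≡ true
  valid-within m {k} k≤2m = trans (cong (λ n → suc k ≤ᵇ n) (ℕP.+-suc m (m + 0))) (≤ᵇ-true (s≤s k≤2m))

  valid-beyond : ∀ m {k} → 2 * m ≤ k → valid m (+ k) ≡ false
  valid-beyond zero            _         = refl
  valid-beyond (suc m) {suc k} 2m+2≤k+1 =
    trans (cong (λ n → suc k ≤ᵇ n) (ℕP.+-suc m (m + 0))) (≤ᵇ-false (subst (_≤ suc k) (ℕP.*-suc 2 m) 2m+2≤k+1))

  valid-nonpos : ∀ m {k} → k ℤ.≤ + 0 → valid m k ≡ false
  valid-nonpos zero                _        = refl
  valid-nonpos (suc m) {+ zero}    _        = refl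
  valid-nonpos (suc m) { -[1+ n ]} _        = refl
  valid-nonpos (suc m) {+ suc n}   (+≤+ ())

  LΔ-latticeSum : ∀ m k r → LΔ m (+ suc k) r ≡ latticeSum r m (indicator (r * k) (r * suc k))
  LΔ-latticeSum m k r = trans (latticeCount-latticeSum m r _) (latticeSum-cong r m bounds)
    where
    bounds : ∀ t → 𝟙 ((+ r ℤ.* + k ℤ.≤ᵇ + t) ∧ (+ t ℤ.≤ᵇ + r ℤ.* + suc k)) ≡ indicator (r * k) (r * suc k) t
    bounds t rewrite sym (ℤP.pos-* r k) | sym (ℤP.pos-* r (suc k)) = refl

  LΔ'-latticeSum : ∀ m k r →
                   LΔ' m (+ suc (suc k)) r ≡ latticeSum r m (indicator (suc (r * suc k)) (r * suc (suc k)))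
  LΔ'-latticeSum m k r = trans (latticeCount-latticeSum m r _) (latticeSum-cong r m bounds)
    where
    bounds : ∀ t → 𝟙 ((+ r ℤ.* + suc k ℤ.+ + 1 ℤ.≤ᵇ + t) ∧ (+ t ℤ.≤ᵇ + r ℤ.* + suc (suc k)))
                 ≡ indicator (suc (r * suc k)) (r * suc (suc k)) t
    bounds t rewrite sym (ℤP.pos-* r (suc k)) | sym (ℤP.pos-* r (suc (suc k))) | ℕP.+-comm (r * suc k) 1 = refl

  LΔ'-beyond : ∀ m k r → 2 * m ≤ k → LΔ' (suc m) (+ suc (suc k)) r ≡ 0
  LΔ'-beyond m k r 2m≤k =
    trans (LΔ'-latticeSum (suc m) k r)
          (latticeSum-zero r m _ (λ t t≤top → indicator-below (s≤s (ℕP.≤-trans t≤top top≤r[k+1]))))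
    where
    top≤r[k+1] : r + m * (2 * r) ≤ r * suc k
    top≤r[k+1] = subst (_≤ r * suc k) (sym (identity r m)) (ℕP.*-monoʳ-≤ r (s≤s 2m≤k))
      where
      identity : ∀ r m → r + m * (2 * r) ≡ r * suc (2 * m)
      identity = solve-∀

  LΔ'₀≡LΔ' : ∀ m k r → LΔ'₀ (suc m) (+ suc (suc k)) r ≡ LΔ' (suc m) (+ suc (suc k)) r
  LΔ'₀≡LΔ' m k r with suc k ≤? 2 * m
  ... | yes k+1≤2m = if-true (valid-within m k+1≤2m)
  ... | no  k+1≰2m = trans (if-false (valid-beyond (suc m) 2m+2≤k+2)) (sym (LΔ'-beyond m k r 2m≤k))
    where
    2m≤k : 2 * m ≤ k
    2m≤k = ℕP.≤-pred (ℕP.≰⇒> k+1≰2m)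
    2m+2≤k+2 : 2 * suc m ≤ suc (suc k)
    2m+2≤k+2 = subst (_≤ suc (suc k)) (sym (ℕP.*-suc 2 m)) (s≤s (s≤s 2m≤k))

  LΔ-top-slice : ∀ m i r →
    LΔ (suc (suc m)) (+ suc (suc i)) r
      ≡ LΔ' (suc (suc m)) (+ suc (suc i)) r + latticeSum r (suc m) (indicator (r * suc i ∸ 2 * r) (r * suc i))
  LΔ-top-slice m i r = begin
    LΔ (suc (suc m)) (+ suc (suc i)) r
      ≡⟨ LΔ-latticeSum (suc (suc m)) (suc i) r ⟩
    latticeSum r (suc (suc m)) (indicator c top)
      ≡⟨ latticeSum-cong r (suc (suc m)) (indicator-split ℕP.≤-refl (ℕP.*-monoʳ-≤ r (ℕP.n≤1+n (suc i)))) ⟩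
    latticeSum r (suc (suc m)) (λ t → indicator c c t + indicator (suc c) top t)
      ≡⟨ latticeSum-+ r (suc (suc m)) _ _ ⟩
    latticeSum r (suc (suc m)) (indicator c c) + latticeSum r (suc (suc m)) (indicator (suc c) top)
      ≡⟨ ℕP.+-comm (latticeSum r (suc (suc m)) (indicator c c)) _ ⟩
    latticeSum r (suc (suc m)) (indicator (suc c) top) + latticeSum r (suc (suc m)) (indicator c c)
      ≡⟨ cong₂ _+_ (sym (LΔ'-latticeSum (suc (suc m)) i r))
                   (trans (latticeSum-suc r m (indicator c c))
                          (latticeSum-cong r (suc m) (sumTo-indicator-point (2 * r) c))) ⟩
    LΔ' (suc (suc m)) (+ suc (suc i)) r + latticeSum r (suc m) (indicator (c ∸ 2 * r) c)
      ∎
    where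
    open ≡-Reasoning
    c   = r * suc i
    top = r * suc (suc i)

  slice-decomposition : ∀ m i r → i ≤ suc (2 * m) →
    latticeSum r (suc m) (indicator (r * suc i ∸ 2 * r) (r * suc i))
      ≡ LΔ'₀ (suc m) (+ suc i) r + LΔ₀ (suc m) (+ i) r
  slice-decomposition m zero r _ = begin
    latticeSum r (suc m) (indicator (r * 1 ∸ 2 * r) (r * 1))
      ≡⟨ latticeSum-cong r (suc m) (λ t → cong (λ lo → indicator lo (r * 1) t) r∸2r≡r*0) ⟩
    latticeSum r (suc m) (indicator (r * 0) (r * 1))
      ≡⟨ LΔ-latticeSum (suc m) 0 r ⟨
    LΔ (suc m) (+ 1) r
      ≡⟨ if-true (valid-within m z≤n) ⟨
    LΔ'₀ (suc m) (+ 1) r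
      ≡⟨ ℕP.+-identityʳ _ ⟨
    LΔ'₀ (suc m) (+ 1) r + LΔ₀ (suc m) (+ 0) r
      ∎
    where
    open ≡-Reasoning
    r∸2r≡r*0 : r * 1 ∸ 2 * r ≡ r * 0
    r∸2r≡r*0 = trans (ℕP.m≤n⇒m∸n≡0 (subst (_≤ 2 * r) (sym (ℕP.*-identityʳ r)) (ℕP.m≤m+n r _)))
                     (sym (ℕP.*-zeroʳ r))
  slice-decomposition m (suc i) r i+1≤2m+1 = begin
    latticeSum r (suc m) (indicator (r * suc (suc i) ∸ 2 * r) (r * suc (suc i)))
      ≡⟨ latticeSum-cong r (suc m) (λ t → cong (λ lo → indicator lo (r * suc (suc i)) t) r[i+2]∸2r≡ri) ⟩
    latticeSum r (suc m) (indicator (r * i) (r * suc (suc i)))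
      ≡⟨ latticeSum-cong r (suc m) (indicator-split (ℕP.*-monoʳ-≤ r (ℕP.n≤1+n i))
                                                     (ℕP.*-monoʳ-≤ r (ℕP.n≤1+n (suc i)))) ⟩
    latticeSum r (suc m) (λ t → indicator (r * i) (r * suc i) t + indicator (suc (r * suc i)) (r * suc (suc i)) t)
      ≡⟨ latticeSum-+ r (suc m) _ _ ⟩
    latticeSum r (suc m) (indicator (r * i) (r * suc i))
      + latticeSum r (suc m) (indicator (suc (r * suc i)) (r * suc (suc i)))
      ≡⟨ cong₂ _+_ (LΔ-latticeSum (suc m) i r) (LΔ'-latticeSum (suc m) i r) ⟨
    LΔ (suc m) (+ suc i) r + LΔ' (suc m) (+ suc (suc i)) r
      ≡⟨ cong₂ _+_ (if-true (valid-within m (ℕP.≤-pred i+1≤2m+1))) (LΔ'₀≡LΔ' m i r) ⟨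
    LΔ₀ (suc m) (+ suc i) r + LΔ'₀ (suc m) (+ suc (suc i)) r
      ≡⟨ ℕP.+-comm (LΔ₀ (suc m) (+ suc i) r) _ ⟩
    LΔ'₀ (suc m) (+ suc (suc i)) r + LΔ₀ (suc m) (+ suc i) r
      ∎
    where
    open ≡-Reasoning
    r[i+2]∸2r≡ri : r * suc (suc i) ∸ 2 * r ≡ r * i
    r[i+2]∸2r≡ri = trans (cong (_∸ 2 * r) (identity r i)) (ℕP.m+n∸m≡n (2 * r) (r * i))
      where
      identity : ∀ r i → r * suc (suc i) ≡ 2 * r + r * i
      identity = solve-∀

  LΔ₀-recurrence-within : ∀ m j r → j ≤ 2 * m →
    LΔ₀ (suc m) (+ suc j) r ≡ LΔ'₀ (suc m) (+ suc j) r + (LΔ'₀ m (+ j) r + LΔ₀ m (+ suc j ℤ.- + 2) r)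
  LΔ₀-recurrence-within m zero r _ =
    trans (if-true (valid-within m z≤n))
          (sym (trans (cong₂ _+_ (if-true (valid-within m z≤n))
                                 (cong₂ _+_ (if-false (valid-nonpos m (+≤+ z≤n))) (if-false (valid-nonpos m ℤ.-≤+))))
                      (ℕP.+-identityʳ _)))
  LΔ₀-recurrence-within (suc m) (suc i) r i+1≤2m+2 = begin
    LΔ₀ (suc (suc m)) (+ suc (suc i)) r
      ≡⟨ if-true (valid-within (suc m) i+1≤2m+2) ⟩
    LΔ (suc (suc m)) (+ suc (suc i)) r
      ≡⟨ LΔ-top-slice m i r ⟩
    LΔ' (suc (suc m)) (+ suc (suc i)) r + latticeSum r (suc m) (indicator (r * suc i ∸ 2 * r) (r * suc i))
      ≡⟨ cong₂ _+_ (sym (if-true (valid-within (suc m) i+1≤2m+2))) (slice-decomposition m i r i≤2m+1) ⟩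
    LΔ'₀ (suc (suc m)) (+ suc (suc i)) r + (LΔ'₀ (suc m) (+ suc i) r + LΔ₀ (suc m) (+ i) r)
      ∎
    where
    open ≡-Reasoning
    i≤2m+1 : i ≤ suc (2 * m)
    i≤2m+1 = ℕP.≤-pred (subst (suc i ≤_) (ℕP.*-suc 2 m) i+1≤2m+2)

  LΔ₀-recurrence-beyond : ∀ m j r → 2 * m ≤ j →
    LΔ₀ (suc m) (+ suc (suc j)) r ≡ LΔ'₀ (suc m) (+ suc (suc j)) r + (LΔ'₀ m (+ suc j) r + LΔ₀ m (+ j) r)
  LΔ₀-recurrence-beyond m j r 2m≤j =
    trans (if-false beyond) (sym (cong₂ _+_ (if-false beyond)
                                            (cong₂ _+_ (if-false (valid-beyond m (ℕP.m≤n⇒m≤1+n 2m≤j)))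
                                                       (if-false (valid-beyond m 2m≤j)))))
    where
    beyond : valid (suc m) (+ suc (suc j)) ≡ false
    beyond = valid-beyond (suc m) (subst (_≤ suc (suc j)) (sym (ℕP.*-suc 2 m)) (s≤s (s≤s 2m≤j)))

  LΔ₀-recurrence : ∀ n k r →
    LΔ₀ n k r ≡ LΔ'₀ n k r + (LΔ'₀ (n ∸ 1) (k ℤ.- + 1) r + LΔ₀ (n ∸ 1) (k ℤ.- + 2) r)
  LΔ₀-recurrence zero    k                r = refl
  LΔ₀-recurrence (suc m) (+ zero)         r =
    sym (cong₂ _+_ (if-false (valid-nonpos m ℤ.-≤+)) (if-false (valid-nonpos m ℤ.-≤+)))
  LΔ₀-recurrence (suc m) -[1+ n ]         r =
    sym (cong₂ _+_ (if-false (valid-nonpos m ℤ.-≤+)) (if-false (valid-nonpos m ℤ.-≤+)))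
  LΔ₀-recurrence (suc m) (+ suc zero)     r = LΔ₀-recurrence-within m zero r z≤n
  LΔ₀-recurrence (suc m) (+ suc (suc j))  r with suc j ≤? 2 * m
  ... | yes j+1≤2m = LΔ₀-recurrence-within m (suc j) r j+1≤2m
  ... | no  j+1≰2m = LΔ₀-recurrence-beyond m j r (ℕP.≤-pred (ℕP.≰⇒> j+1≰2m))

open LatticePointCounts using (LΔ₀; LΔ'₀; LΔ₀-recurrence)
open import Data.Integer using (_+_; _-_)

oneMinusT-cong : ∀ {a b : Series} → a ≗ b → oneMinusT a ≗ oneMinusT b
oneMinusT-cong a≗b zero    = a≗b zero
oneMinusT-cong a≗b (suc i) = cong₂ _-_ (a≗b (suc i)) (a≗b i)

oneMinusT-+ : ∀ (a b : Series) → oneMinusT (λ l → a l + b l) ≗ λ i → oneMinusT a i + oneMinusT b i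
oneMinusT-+ a b zero    = refl
oneMinusT-+ a b (suc i) = interchange (a (suc i)) (b (suc i)) (a i) (b i)
  where
  interchange : ∀ a b c d → (a + b) - (c + d) ≡ (a - c) + (b - d)
  interchange = ℤSolver.solve-∀

oneMinusT-zero : oneMinusT (λ _ → + 0) ≗ λ _ → + 0
oneMinusT-zero zero    = refl
oneMinusT-zero (suc i) = refl

oneMinusTPow-cong : ∀ j {a b : Series} → a ≗ b → oneMinusTPow j a ≗ oneMinusTPow j b
oneMinusTPow-cong zero    a≗b = a≗b
oneMinusTPow-cong (suc j) a≗b = oneMinusT-cong (oneMinusTPow-cong j a≗b)

oneMinusTPow-+ : ∀ j (a b : Series) →
                 oneMinusTPow j (λ l → a l + b l) ≗ λ i → oneMinusTPow j a i + oneMinusTPow j b i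
oneMinusTPow-+ zero    a b i = refl
oneMinusTPow-+ (suc j) a b i =
  trans (oneMinusT-cong (oneMinusTPow-+ j a b) i) (oneMinusT-+ (oneMinusTPow j a) (oneMinusTPow j b) i)

oneMinusTPow-zero : ∀ j → oneMinusTPow j (λ _ → + 0) ≗ λ _ → + 0
oneMinusTPow-zero zero    i = refl
oneMinusTPow-zero (suc j) i = trans (oneMinusT-cong (oneMinusTPow-zero j) i) (oneMinusT-zero i)

sumFrom1-cong : ∀ n {f g : ℕ → Series} → (∀ j → f j ≗ g j) → sumFrom1 n f ≗ sumFrom1 n g
sumFrom1-cong zero    f≗g i = refl
sumFrom1-cong (suc n) f≗g i = cong₂ _+_ (f≗g 1 i) (sumFrom1-cong n (f≗g ∘ suc) i)

oneMinusT-sumFrom1 : ∀ n (f : ℕ → Series) → oneMinusT (sumFrom1 n f) ≗ sumFrom1 n (λ j → oneMinusT (f j))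
oneMinusT-sumFrom1 zero    f = oneMinusT-zero
oneMinusT-sumFrom1 (suc n) f i =
  trans (oneMinusT-+ (f 1) (sumFrom1 n (f ∘ suc)) i)
        (cong (λ s → oneMinusT (f 1) i + s) (oneMinusT-sumFrom1 n (f ∘ suc) i))

-- h*-polynomials and multiplication by 1 − t

hstarOf-cong : ∀ m {L M : ℕ → ℕ} → L ≗ M → hstarOf m L ≗ hstarOf m M
hstarOf-cong m L≗M = oneMinusTPow-cong (suc m) (cong +_ ∘ L≗M)

hstarOf-+ : ∀ m (L M : ℕ → ℕ) → hstarOf m (λ r → L r ℕ.+ M r) ≗ λ i → hstarOf m L i + hstarOf m M i
hstarOf-+ m L M = oneMinusTPow-+ (suc m) (λ r → + L r) (λ r → + M r)

if-hstarOf : ∀ b m L → (λ i → if b then hstarOf m L i else + 0) ≗ hstarOf m (λ r → if b then L r else 0)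
if-hstarOf true  m L i = refl
if-hstarOf false m L i = sym (oneMinusTPow-zero (suc m) i)

hΔ-hstarOf : ∀ n k → hΔ n k ≗ hstarOf n (LΔ₀ n k)
hΔ-hstarOf n k = if-hstarOf (valid n k) n (LΔ n k)

hΔ'-hstarOf : ∀ n k → hΔ' n k ≗ hstarOf n (LΔ'₀ n k)
hΔ'-hstarOf n k = if-hstarOf (valid n k) n (LΔ' n k)

hΔ-recurrence : ∀ n k →
  hΔ n k ≗ λ i → hΔ' n k i + oneMinusT (λ l → hΔ' (n ∸ 1) (k - + 1) l + hΔ (n ∸ 1) (k - + 2) l) i
hΔ-recurrence zero    k i = sym (cong (λ s → + 0 + s) (oneMinusT-zero i))
hΔ-recurrence (suc m) k i = begin
  hΔ (suc m) k i
    ≡⟨ hΔ-hstarOf (suc m) k i ⟩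
  hstarOf (suc m) (LΔ₀ (suc m) k) i
    ≡⟨ hstarOf-cong (suc m) (LΔ₀-recurrence (suc m) k) i ⟩
  hstarOf (suc m) (λ r → LΔ'₀ (suc m) k r ℕ.+ (LΔ'₀ m (k - + 1) r ℕ.+ LΔ₀ m (k - + 2) r)) i
    ≡⟨ hstarOf-+ (suc m) (LΔ'₀ (suc m) k) _ i ⟩
  hstarOf (suc m) (LΔ'₀ (suc m) k) i + oneMinusT (hstarOf m (λ r → LΔ'₀ m (k - + 1) r ℕ.+ LΔ₀ m (k - + 2) r)) i
    ≡⟨ cong₂ _+_ (sym (hΔ'-hstarOf (suc m) k i)) (oneMinusT-cong lower i) ⟩
  hΔ' (suc m) k i + oneMinusT (λ l → hΔ' m (k - + 1) l + hΔ m (k - + 2) l) i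
    ∎
  where
  open ≡-Reasoning
  lower : hstarOf m (λ r → LΔ'₀ m (k - + 1) r ℕ.+ LΔ₀ m (k - + 2) r) ≗ λ l → hΔ' m (k - + 1) l + hΔ m (k - + 2) l
  lower l = trans (hstarOf-+ m _ _ l) (sym (cong₂ _+_ (hΔ'-hstarOf m (k - + 1) l) (hΔ-hstarOf m (k - + 2) l)))

expansionTerm : ℕ → ℤ → ℕ → Series
expansionTerm n k j = oneMinusTPow j (λ l → hΔ' (n ∸ j) (k - + (2 * j) + + 1) l + hΔ' (n ∸ j) (k - + (2 * j)) l)

expansionTerm-one : ∀ n k → expansionTerm (suc n) k 1 ≗ oneMinusT (λ l → hΔ' n (k - + 1) l + hΔ' n (k - + 2) l)
expansionTerm-one n k = oneMinusT-cong (λ l → cong (λ k′ → hΔ' n k′ l + hΔ' n (k - + 2) l) (k-2+1≡k-1 k))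
  where
  k-2+1≡k-1 : ∀ k → k - + 2 + + 1 ≡ k - + 1
  k-2+1≡k-1 = ℤSolver.solve-∀

expansionTerm-suc : ∀ n k j → expansionTerm (suc n) k (suc j) ≗ oneMinusT (expansionTerm n (k - + 2) j)
expansionTerm-suc n k j =
  oneMinusT-cong (oneMinusTPow-cong j
    (λ l → cong (λ k′ → hΔ' (n ∸ j) (k′ + + 1) l + hΔ' (n ∸ j) k′ l) shift))
  where
  assoc : ∀ k x → k - (+ 2 + x) ≡ k - + 2 - x
  assoc = ℤSolver.solve-∀
  shift : k - + (2 * suc j) ≡ k - + 2 - + (2 * j)
  shift = trans (cong (λ x → k - + x) (ℕP.*-suc 2 j)) (assoc k (+ (2 * j)))

hΔ-expansion : ∀ n k → hΔ n k ≗ λ i → hΔ' n k i + sumFrom1 n (expansionTerm n k) i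
hΔ-expansion zero    k i = refl
hΔ-expansion (suc n) k i = begin
  hΔ (suc n) k i
    ≡⟨ hΔ-recurrence (suc n) k i ⟩
  hΔ' (suc n) k i + oneMinusT (λ l → hΔ' n (k - + 1) l + hΔ n (k - + 2) l) i
    ≡⟨ cong (λ s → hΔ' (suc n) k i + s) (oneMinusT-cong unfold i) ⟩
  hΔ' (suc n) k i + oneMinusT (λ l → (hΔ' n (k - + 1) l + hΔ' n (k - + 2) l) + rest l) i
    ≡⟨ cong (λ s → hΔ' (suc n) k i + s) (trans (oneMinusT-+ _ rest i)
                                               (cong₂ _+_ (sym (expansionTerm-one n k i)) later)) ⟩
  hΔ' (suc n) k i + sumFrom1 (suc n) (expansionTerm (suc n) k) i
    ∎
  where
  open ≡-Reasoning
  rest : Series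
  rest = sumFrom1 n (expansionTerm n (k - + 2))
  unfold : (λ l → hΔ' n (k - + 1) l + hΔ n (k - + 2) l) ≗ λ l → (hΔ' n (k - + 1) l + hΔ' n (k - + 2) l) + rest l
  unfold l = trans (cong (λ s → hΔ' n (k - + 1) l + s) (hΔ-expansion n (k - + 2) l))
                   (sym (ℤP.+-assoc (hΔ' n (k - + 1) l) _ _))
  later : oneMinusT rest i ≡ sumFrom1 n (λ j → expansionTerm (suc n) k (suc j)) i
  later = trans (oneMinusT-sumFrom1 n (expansionTerm n (k - + 2)) i)
                (sumFrom1-cong n (λ j → sym ∘ expansionTerm-suc n k j) i)

proposition6p1 : (n k : ℕ) → 1 ≤ n → 1 ≤ k → k ≤ 2 * n ∸ 1 →
    ((i : ℕ) → hΔ n (+ k) i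
      ≡ hΔ' n (+ k) i
        + oneMinusT (λ l → hΔ' (n ∸ 1) (+ k - + 1) l + hΔ (n ∸ 1) (+ k - + 2) l) i)
    × ((i : ℕ) → hΔ n (+ k) i
      ≡ hΔ' n (+ k) i
        + sumFrom1 n (λ j → oneMinusTPow j (λ l →
            hΔ' (n ∸ j) (+ k - + (2 * j) + + 1) l + hΔ' (n ∸ j) (+ k - + (2 * j)) l)) i)
proposition6p1 n k _ _ _ = hΔ-recurrence n (+ k) , hΔ-expansion n (+ k)
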